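{- Let $(X,\pi,\alpha)$ be an invertible, equilibrium bound micro-macro dynamical system satisfying property $\mathrm{G}_0(\varepsilon)$, and let $r,e:X\to\mathbb{N}$ be the first return time and equilibrium reaching time maps. Then the mean of $e/r$ with respect to the uniform probability on $X$ satisfies $\displaystyle\frac{1}{|X|}\sum_{i\in X}\frac{e(i)}{r(i)}\le\varepsilon$.
   Context: $X$ is a finite set, $\pi$ a partition of $X$, $\alpha$ a permutation of $X$. $X^{\mathrm{eq}}$ is the union of the blocks of $\pi$ of maximal cardinality, $X^{\mathrm{neq}}=X\setminus X^{\mathrm{eq}}$. The system is equilibrium bound if every $\alpha$-orbit meets $X^{\mathrm{eq}}$. It satisfies $\mathrm{G}_0(\varepsilon)$ if every $\alpha$-orbit $c$ satisfies $|c\cap X^{\mathrm{eq}}|\ge(1-\varepsilon)|c|$. $r(i)$ is the cardinality of the $\alpha$-orbit of $i$, and $e(i)$ is the smallest $k\in\mathbb{N}$ with $\alpha^k(i)\in X^{\mathrm{eq}}$.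
   Formalization: The parameter ε of property $\mathrm{G}_0(\varepsilon)$ and of the bound is a rational number rather than a real number. -}

module Defs where

open import Data.Nat as ℕ using (ℕ; zero; suc)
open import Data.Fin using (Fin; toℕ)
open import Data.Fin.Properties using (any?; all?)
open import Data.Fin.Permutation using (Permutation′; _⟨$⟩ʳ_)
open import Data.Bool using (Bool; true; false; if_then_else_)
open import Data.Product using (∃; Σ; _,_)
open import Data.Integer using (+_)
open import Data.Rational as ℚ using (ℚ; 0ℚ; 1ℚ)
open import Relation.Nullary using (Dec; yes; no; ¬_)
open import Relation.Nullary.Decidable using (⌊_⌋)
open import Relation.Binary.PropositionalEquality using (_≡_)
open import Data.Fin using (_≟_)

-- A micro-macro dynamical system on X = Fin n:
--   the partition π is given by a block-labelling map  block : Fin n → Fin m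
--   (the blocks of π are the nonempty fibres of this map);
--   α is a permutation of Fin n (invertible system).

count : ∀ {n} → (Fin n → Bool) → ℕ
count {zero}  p = 0
count {suc n} p = (if p Fin.zero then 1 else 0) ℕ.+ count (λ i → p (Fin.suc i))
  where import Data.Fin as Fin

sumℚ : ∀ {n} → (Fin n → ℚ) → ℚ
sumℚ {zero}  f = 0ℚ
sumℚ {suc n} f = f Fin.zero ℚ.+ sumℚ (λ i → f (Fin.suc i))
  where import Data.Fin as Fin

iter : ∀ {n} → Permutation′ n → ℕ → Fin n → Fin n
iter α zero    i = i
iter α (suc k) i = α ⟨$⟩ʳ iter α k i

blockSize : ∀ {n m} → (Fin n → Fin m) → Fin m → ℕ
blockSize block b = count (λ x → ⌊ block x ≟ b ⌋)

IsEq : ∀ {n m} → (Fin n → Fin m) → Fin n → Set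
IsEq {m = m} block x = (b : Fin m) → blockSize block b ℕ.≤ blockSize block (block x)

isEq? : ∀ {n m} (block : Fin n → Fin m) (x : Fin n) → Dec (IsEq block x)
isEq? block x = all? (λ b → blockSize block b ℕ.≤? blockSize block (block x))

-- j lies in the α-orbit of i  (the orbit of i is {α^k i | k < n} since |X| = n).
InOrbit : ∀ {n} → Permutation′ n → Fin n → Fin n → Set
InOrbit {n} α i j = ∃ λ (k : Fin n) → iter α (toℕ k) i ≡ j

inOrbit? : ∀ {n} (α : Permutation′ n) (i j : Fin n) → Dec (InOrbit α i j)
inOrbit? α i j = any? (λ k → iter α (toℕ k) i ≟ j)

r : ∀ {n} → Permutation′ n → Fin n → ℕ
r α i = count (λ j → ⌊ inOrbit? α i j ⌋)

orbitEqCount : ∀ {n m} → (Fin n → Fin m) → Permutation′ n → Fin n → ℕ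
orbitEqCount block α i = count (λ j → ⌊ inOrbit? α i j ⌋ Data.Bool.∧ ⌊ isEq? block j ⌋)
  where import Data.Bool

firstHit : (ℕ → Bool) → ℕ → ℕ → ℕ
firstHit p zero       start = start
firstHit p (suc fuel) start = if p start then start else firstHit p fuel (suc start)

-- e(i): least k ∈ ℕ with α^k(i) ∈ X^eq.  Such k (if any) is < n, since
-- α^k(i) runs through the orbit of i with period ≤ n; the fallback value n
-- is never used for equilibrium bound systems.
e : ∀ {n m} → (Fin n → Fin m) → Permutation′ n → Fin n → ℕ
e {n} block α i = firstHit (λ k → ⌊ isEq? block (iter α k i) ⌋) n 0

EquilibriumBound : ∀ {n m} → (Fin n → Fin m) → Permutation′ n → Set
EquilibriumBound block α = ∀ i → ∃ λ (k : ℕ) → IsEq block (iter α k i)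

-- a / b as a rational (b = 0 is mapped to 0; never used since r(i) ≥ 1).
frac : ℕ → ℕ → ℚ
frac a zero    = 0ℚ
frac a (suc b) = (+ a) ℚ./ suc b

-- Property G₀(ε): every orbit c satisfies |c ∩ X^eq| ≥ (1 - ε)|c|.
-- Orbits are indexed by their points i (c = orbit of i).
G₀ : ∀ {n m} → (Fin n → Fin m) → Permutation′ n → ℚ → Set
G₀ block α ε = ∀ i → (1ℚ ℚ.- ε) ℚ.* frac (r α i) 1 ℚ.≤ frac (orbitEqCount block α i) 1

module Submission where

-- Fix a point i with orbit c = {α^k i}.  By minimality of e(i) the
-- points α^0 i, …, α^(e(i)-1) i lie outside X^eq, and they are pairwise
-- distinct: a coincidence α^a i = α^b i with a < b < e(i) would make the
-- orbit recur among its first b points, so the equilibrium point that every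
-- orbit contains (equilibrium boundedness) would be hit before time e(i).
-- Hence these are e(i) distinct points of c ∖ X^eq, and
--      e(i) + |c ∩ X^eq| ≤ |c| = r(i).
-- Together with G₀(ε), |c ∩ X^eq| ≥ (1-ε) r(i), this gives e(i)/r(i) ≤ ε
-- for every i, and the mean of numbers all ≤ ε is ≤ ε.

module Counting where

  open import Data.Nat using (zero; suc; _+_; _≤_)
  import Data.Nat.Properties as ℕP
  open import Data.Fin using (Fin; zero; suc)
  open import Data.Fin.Properties using (injective⇒≤; suc-injective)
  open import Data.Bool using (Bool; true; false; _∧_; not)
  open import Function using (_∘_; Injective)
  open import Relation.Nullary using (Dec; ¬_)
  open import Relation.Nullary.Decidable using (⌊_⌋; isYes≗does; dec-true; dec-false)
  open import Relation.Binary.PropositionalEquality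
  open import Defs using (count)

  count-split : ∀ {n} (p q : Fin n → Bool) →
    count p ≡ count (λ j → p j ∧ q j) + count (λ j → p j ∧ not (q j))
  count-split {zero}  p q = refl
  count-split {suc n} p q with p zero | q zero | count-split (p ∘ suc) (q ∘ suc)
  ... | true  | true  | split = cong suc split
  ... | true  | false | split = trans (cong suc split) (sym (ℕP.+-suc _ _))
  ... | false | _     | split = split

  -- The position of x among the elements satisfying p; it identifies the
  -- set {x | p x} with a subset of Fin (count p).
  rank : ∀ {n} (p : Fin n → Bool) (x : Fin n) → p x ≡ true → Fin (count p)
  rank p zero px with p zero
  rank p zero px | true  = zero
  rank p zero () | false
  rank p (suc x) px with p zero
  ... | true  = suc (rank (p ∘ suc) x px)
  ... | false = rank (p ∘ suc) x px

  rank-injective : ∀ {n} (p : Fin n → Bool) {x y : Fin n} (px : p x ≡ true) (py : p y ≡ true) →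
    rank p x px ≡ rank p y py → x ≡ y
  rank-injective p {zero}  {zero}  px py same = refl
  rank-injective p {zero}  {suc y} px py same with p zero
  rank-injective p {zero}  {suc y} px py ()   | true
  rank-injective p {zero}  {suc y} () py same | false
  rank-injective p {suc x} {zero}  px py same with p zero
  rank-injective p {suc x} {zero}  px py ()   | true
  rank-injective p {suc x} {zero}  px () same | false
  rank-injective p {suc x} {suc y} px py same with p zero
  ... | true  = cong suc (rank-injective (p ∘ suc) px py (suc-injective same))
  ... | false = cong suc (rank-injective (p ∘ suc) px py same)

  injection⇒≤count : ∀ {n k} (p : Fin n → Bool) (f : Fin k → Fin n) →
    Injective _≡_ _≡_ f → (∀ x → p (f x) ≡ true) → k ≤ count p
  injection⇒≤count p f f-injective pf =
    injective⇒≤ (λ same → f-injective (rank-injective p (pf _) (pf _) same))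

  ⌊⌋-true : ∀ {a} {A : Set a} (d : Dec A) → A → ⌊ d ⌋ ≡ true
  ⌊⌋-true d a = trans (isYes≗does d) (dec-true d a)

  ⌊⌋-false : ∀ {a} {A : Set a} (d : Dec A) → ¬ A → ⌊ d ⌋ ≡ false
  ⌊⌋-false d ¬a = trans (isYes≗does d) (dec-false d ¬a)

module Orbits where

  open import Data.Nat as ℕ using (zero; suc; _+_; _∸_; _≤_; _<_; z≤n; NonZero)
  import Data.Nat.Properties as ℕP
  open import Data.Nat.Induction using (<-rec)
  open import Data.Fin using (Fin; toℕ; fromℕ<)
  open import Data.Fin.Properties using (toℕ-injective; toℕ<n; toℕ-fromℕ<; nonZeroIndex)
  open import Data.Fin.Permutation using (Permutation′; _⟨$⟩ʳ_)
  open import Data.Bool using (Bool; true; false; _∧_; not)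
  open import Data.Product using (∃-syntax; _×_; _,_)
  open import Data.Empty using (⊥-elim)
  open import Data.Sum using (inj₁; inj₂)
  open import Function using (Injective)
  open import Relation.Binary.Definitions using (tri<; tri≈; tri>)
  open import Relation.Nullary using (yes; no; ¬_)
  open import Relation.Nullary.Decidable using (⌊_⌋)
  open import Relation.Binary.PropositionalEquality
  open import Defs
  open Counting

  iter-+ : ∀ {n} (α : Permutation′ n) k j i → iter α (k + j) i ≡ iter α k (iter α j i)
  iter-+ α zero    j i = refl
  iter-+ α (suc k) j i = cong (α ⟨$⟩ʳ_) (iter-+ α k j i)

  iter-recurrent : ∀ {n} (α : Permutation′ n) i {a b} → a < b → iter α a i ≡ iter α b i →
    ∀ K → ∃[ K′ ] K′ < b × iter α K′ i ≡ iter α K i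
  iter-recurrent α i {a} {b} a<b loop = <-rec _ reduce
    where
    shift : ∀ t → iter α (t + a) i ≡ iter α (t + b) i
    shift t = begin
      iter α (t + a) i      ≡⟨ iter-+ α t a i ⟩
      iter α t (iter α a i) ≡⟨ cong (iter α t) loop ⟩
      iter α t (iter α b i) ≡⟨ iter-+ α t b i ⟨
      iter α (t + b) i      ∎
      where open ≡-Reasoning
    -- For K ≥ b write K = t + b and pass to the earlier time t + a.
    reduce : ∀ K → (∀ {L} → L < K → ∃[ K′ ] K′ < b × iter α K′ i ≡ iter α L i) →
             ∃[ K′ ] K′ < b × iter α K′ i ≡ iter α K i
    reduce K earlier with K ℕP.<? b
    ... | yes K<b = K , K<b , refl
    ... | no  K≮b =
      let t = K ∸ b
          t+b≡K = ℕP.m∸n+n≡m (ℕP.≮⇒≥ K≮b)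
          (K′ , K′<b , same) = earlier (subst (t + a <_) t+b≡K (ℕP.+-monoʳ-< t a<b))
      in K′ , K′<b , trans same (trans (shift t) (cong (λ k → iter α k i) t+b≡K))

  iter-inOrbit : ∀ {n} (α : Permutation′ n) i {k} → k < n → ⌊ inOrbit? α i (iter α k i) ⌋ ≡ true
  iter-inOrbit α i k<n =
    ⌊⌋-true (inOrbit? α i _) (fromℕ< k<n , cong (λ k → iter α k i) (toℕ-fromℕ< k<n))

  -- Every orbit is nonempty: it contains i itself.
  r-nonZero : ∀ {n} (α : Permutation′ n) i → NonZero (r α i)
  r-nonZero α i = nonZeroIndex (rank _ i (iter-inOrbit α i {0} (ℕP.<-≤-trans ℕ.z<s (toℕ<n i))))

  firstHit-≤ : ∀ p fuel s → firstHit p fuel s ≤ s + fuel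
  firstHit-≤ p zero       s = ℕP.≤-reflexive (sym (ℕP.+-identityʳ s))
  firstHit-≤ p (suc fuel) s with p s
  ... | true  = ℕP.m≤m+n s (suc fuel)
  ... | false = ℕP.≤-trans (firstHit-≤ p fuel (suc s)) (ℕP.≤-reflexive (sym (ℕP.+-suc s fuel)))

  firstHit-minimal : ∀ p fuel s {k} → s ≤ k → k < firstHit p fuel s → p k ≡ false
  firstHit-minimal p zero       s s≤k k<s = ⊥-elim (ℕP.≤⇒≯ s≤k k<s)
  firstHit-minimal p (suc fuel) s s≤k k<hit with p s in ps
  ... | true  = ⊥-elim (ℕP.≤⇒≯ s≤k k<hit)
  ... | false with ℕP.m≤n⇒m<n∨m≡n s≤k
  ...   | inj₁ s<k  = firstHit-minimal p fuel (suc s) s<k k<hit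
  ...   | inj₂ refl = ps

  module _ {n m} (block : Fin n → Fin m) (α : Permutation′ n) (i : Fin n) where

    e≤n : e block α i ≤ n
    e≤n = firstHit-≤ _ n 0

    e-minimal : ∀ {k} → k < e block α i → ¬ IsEq block (iter α k i)
    e-minimal k<e isEq with trans (sym (⌊⌋-true (isEq? block _) isEq)) (firstHit-minimal _ n 0 z≤n k<e)
    ... | ()

    module _ (bound : EquilibriumBound block α) where

      -- In an equilibrium bound system the iterates before time e(i) are
      -- pairwise distinct: a repetition would bring the orbit's equilibrium
      -- point forward to a time before e(i).
      pre-equilibrium-distinct : ∀ {a b} → a < b → b < e block α i → iter α a i ≢ iter α b i
      pre-equilibrium-distinct a<b b<e loop =
        let (K , isEq) = bound i
            (K′ , K′<b , same) = iter-recurrent α i a<b loop K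
        in e-minimal (ℕP.<-trans K′<b b<e) (subst (IsEq block) (sym same) isEq)

      pre-equilibrium : Fin (e block α i) → Fin n
      pre-equilibrium x = iter α (toℕ x) i

      pre-equilibrium-injective : Injective _≡_ _≡_ pre-equilibrium
      pre-equilibrium-injective {x} {y} same with ℕP.<-cmp (toℕ x) (toℕ y)
      ... | tri< x<y _ _ = ⊥-elim (pre-equilibrium-distinct x<y (toℕ<n y) same)
      ... | tri≈ _ x≡y _ = toℕ-injective x≡y
      ... | tri> _ _ y<x = ⊥-elim (pre-equilibrium-distinct y<x (toℕ<n x) (sym same))

      e+orbitEqCount≤r : e block α i + orbitEqCount block α i ≤ r α i
      e+orbitEqCount≤r = begin
        e block α i + orbitEqCount block α i   ≡⟨ ℕP.+-comm (e block α i) _ ⟩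
        orbitEqCount block α i + e block α i   ≤⟨ ℕP.+-monoʳ-≤ (orbitEqCount block α i) e≤nonEq ⟩
        orbitEqCount block α i + count nonEq   ≡⟨ count-split inOrbit isEq ⟨
        r α i                                  ∎
        where
        open ℕP.≤-Reasoning
        inOrbit isEq nonEq : Fin n → Bool
        inOrbit j = ⌊ inOrbit? α i j ⌋
        isEq    j = ⌊ isEq? block j ⌋
        nonEq   j = inOrbit j ∧ not (isEq j)
        nonEq-pre-equilibrium : ∀ x → nonEq (pre-equilibrium x) ≡ true
        nonEq-pre-equilibrium x
          rewrite iter-inOrbit α i (ℕP.<-≤-trans (toℕ<n x) e≤n)
                | ⌊⌋-false (isEq? block (pre-equilibrium x)) (e-minimal (toℕ<n x)) = refl
        e≤nonEq : e block α i ≤ count nonEq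
        e≤nonEq = injection⇒≤count nonEq pre-equilibrium pre-equilibrium-injective nonEq-pre-equilibrium

module RationalBounds where

  open import Data.Nat as ℕ using (ℕ; zero; suc; NonZero)
  import Data.Nat.Properties as ℕP
  open import Data.Fin using (Fin; zero; suc)
  open import Data.Integer as ℤ using (+_)
  import Data.Integer.Properties as ℤP
  open import Data.Rational using (ℚ; _/_; _+_; _*_; _-_; _≤_; 1ℚ; toℚᵘ)
  open import Data.Rational.Properties
  open import Data.Rational.Unnormalised as ℚᵘ using (mkℚᵘ; *≡*; *≤*) renaming (_≃_ to _≃ᵘ_)
  import Data.Rational.Unnormalised.Properties as ℚᵘP
  open import Data.Rational.Solver using (module +-*-Solver)
  open import Relation.Binary.PropositionalEquality
  open import Defs using (frac; sumℚ)
  open +-*-Solver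

  -- ℕ embedded in ℚ as a / 1, the form in which G₀ is stated (frac a 1).
  ι : ℕ → ℚ
  ι a = + a / 1

  -- Identities are checked on unnormalised representatives: ι a is mkℚᵘ (+ a) 0
  -- and + a / suc d is mkℚᵘ (+ a) d.
  toℚᵘ-/ : ∀ a d → toℚᵘ (+ a / suc d) ≃ᵘ mkℚᵘ (+ a) d
  toℚᵘ-/ a d = toℚᵘ-fromℚᵘ (mkℚᵘ (+ a) d)

  ι-+ : ∀ a b → ι (a ℕ.+ b) ≡ ι a + ι b
  ι-+ a b = toℚᵘ-injective (begin
    toℚᵘ (ι (a ℕ.+ b))                ≈⟨ toℚᵘ-/ (a ℕ.+ b) 0 ⟩
    mkℚᵘ (+ (a ℕ.+ b)) 0              ≈⟨ *≡* (cong (ℤ._* + 1) sum-numerators) ⟩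
    mkℚᵘ (+ a) 0 ℚᵘ.+ mkℚᵘ (+ b) 0    ≈⟨ ℚᵘP.+-cong (toℚᵘ-/ a 0) (toℚᵘ-/ b 0) ⟨
    toℚᵘ (ι a) ℚᵘ.+ toℚᵘ (ι b)        ≈⟨ toℚᵘ-homo-+ (ι a) (ι b) ⟨
    toℚᵘ (ι a + ι b)                  ∎)
    where
    open import Relation.Binary.Reasoning.Setoid ℚᵘP.≃-setoid
    sum-numerators : + (a ℕ.+ b) ≡ + a ℤ.* + 1 ℤ.+ + b ℤ.* + 1
    sum-numerators = trans (ℤP.pos-+ a b) (sym (cong₂ ℤ._+_ (ℤP.*-identityʳ (+ a)) (ℤP.*-identityʳ (+ b))))

  ι-mono : ∀ {a b} → a ℕ.≤ b → ι a ≤ ι b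
  ι-mono {a} {b} a≤b =
    toℚᵘ-cancel-≤ (ℚᵘP.≤-respˡ-≃ (ℚᵘP.≃-sym (toℚᵘ-/ a 0)) (ℚᵘP.≤-respʳ-≃ (ℚᵘP.≃-sym (toℚᵘ-/ b 0)) cross-multiplied))
    where
    cross-multiplied : mkℚᵘ (+ a) 0 ℚᵘ.≤ mkℚᵘ (+ b) 0
    cross-multiplied = *≤* (subst₂ ℤ._≤_ (sym (ℤP.*-identityʳ (+ a))) (sym (ℤP.*-identityʳ (+ b))) (ℤ.+≤+ a≤b))

  /-*-cancel : ∀ a d → (+ a / suc d) * ι (suc d) ≡ ι a
  /-*-cancel a d = toℚᵘ-injective (begin
    toℚᵘ ((+ a / suc d) * ι (suc d))         ≈⟨ toℚᵘ-homo-* (+ a / suc d) (ι (suc d)) ⟩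
    toℚᵘ (+ a / suc d) ℚᵘ.* toℚᵘ (ι (suc d)) ≈⟨ ℚᵘP.*-cong (toℚᵘ-/ a d) (toℚᵘ-/ (suc d) 0) ⟩
    mkℚᵘ (+ a) d ℚᵘ.* mkℚᵘ (+ suc d) 0      ≈⟨ *≡* (trans (ℤP.*-identityʳ _) (cong (λ x → + a ℤ.* + x) (sym (ℕP.*-identityʳ (suc d))))) ⟩
    mkℚᵘ (+ a) 0                             ≈⟨ toℚᵘ-/ a 0 ⟨
    toℚᵘ (ι a)                               ∎)
    where open import Relation.Binary.Reasoning.Setoid ℚᵘP.≃-setoid

  -- Pointwise bound: if e + q ≤ r and (1 - ε) r ≤ q then e / r ≤ ε,
  -- because e ≤ r - q ≤ r - (1 - ε) r = ε r.
  ratio-≤ : ∀ {e q} r .{{_ : NonZero r}} (ε : ℚ) →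
    e ℕ.+ q ℕ.≤ r → (1ℚ - ε) * ι r ≤ ι q → frac e r ≤ ε
  ratio-≤ {e} {q} (suc r) ε e+q≤r G = *-cancelʳ-≤-pos R {{normalize-pos (suc r) 1}} (begin
    frac e (suc r) * R                  ≡⟨ /-*-cancel e r ⟩
    ι e                                 ≡⟨ solve 3 (λ x y z → x := (x :+ (con 1ℚ :- y) :* z) :+ (y :* z :- z)) refl (ι e) ε R ⟩
    (ι e + (1ℚ - ε) * R) + (ε * R - R)  ≤⟨ +-monoˡ-≤ (ε * R - R) e+G≤R ⟩
    R + (ε * R - R)                     ≡⟨ solve 2 (λ y z → z :+ (y :* z :- z) := y :* z) refl ε R ⟩
    ε * R                               ∎)
    where
    open ≤-Reasoning
    R = ι (suc r)
    e+G≤R : ι e + (1ℚ - ε) * R ≤ R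
    e+G≤R = begin
      ι e + (1ℚ - ε) * R ≤⟨ +-monoʳ-≤ (ι e) G ⟩
      ι e + ι q          ≡⟨ ι-+ e q ⟨
      ι (e ℕ.+ q)        ≤⟨ ι-mono e+q≤r ⟩
      R                  ∎

  sum-≤ : ∀ {k} (ε : ℚ) (f : Fin k → ℚ) → (∀ i → f i ≤ ε) → sumℚ f ≤ ι k * ε
  sum-≤ {zero}  ε f f≤ε = ≤-reflexive (sym (*-zeroˡ ε))
  sum-≤ {suc k} ε f f≤ε = begin
    f zero + sumℚ (λ i → f (suc i)) ≤⟨ +-mono-≤ (f≤ε zero) (sum-≤ ε (λ i → f (suc i)) (λ i → f≤ε (suc i))) ⟩
    ε + ι k * ε                     ≡⟨ solve 2 (λ x y → y :+ x :* y := (con 1ℚ :+ x) :* y) refl (ι k) ε ⟩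
    (1ℚ + ι k) * ε                  ≡⟨ cong (_* ε) (ι-+ 1 k) ⟨
    ι (suc k) * ε                   ∎
    where open ≤-Reasoning

  mean-≤ : ∀ n (ε : ℚ) (f : Fin (suc n) → ℚ) → (∀ i → f i ≤ ε) → (+ 1 / suc n) * sumℚ f ≤ ε
  mean-≤ n ε f f≤ε = begin
    (+ 1 / suc n) * sumℚ f           ≤⟨ *-monoˡ-≤-nonNeg (+ 1 / suc n) {{normalize-nonNeg 1 (suc n)}} (sum-≤ ε f f≤ε) ⟩
    (+ 1 / suc n) * (ι (suc n) * ε)  ≡⟨ *-assoc (+ 1 / suc n) (ι (suc n)) ε ⟨
    ((+ 1 / suc n) * ι (suc n)) * ε  ≡⟨ cong (_* ε) (/-*-cancel 1 n) ⟩
    1ℚ * ε                           ≡⟨ *-identityˡ ε ⟩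
    ε                                ∎
    where open ≤-Reasoning

open import Defs
open import Data.Nat using (ℕ; NonZero; suc)
open import Data.Fin using (Fin)
open import Data.Fin.Permutation using (Permutation′)
open import Data.Integer using (+_)
open import Data.Rational using (ℚ; _/_; _*_; _≤_)
open Orbits using (r-nonZero; e+orbitEqCount≤r)
open RationalBounds using (ratio-≤; mean-≤)

mainTheorem16 : (n m : ℕ) → .{{_ : NonZero n}} →
    (block : Fin n → Fin m) → (α : Permutation′ n) → (ε : ℚ) →
    EquilibriumBound block α → G₀ block α ε →
    ((+ 1) / n) * sumℚ (λ i → frac (e block α i) (r α i)) ≤ ε
mainTheorem16 (suc n) m block α ε bound g₀ = mean-≤ n ε _ e/r≤ε
  where
  e/r≤ε : ∀ i → frac (e block α i) (r α i) ≤ ε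
  e/r≤ε i = ratio-≤ (r α i) {{r-nonZero α i}} ε (e+orbitEqCount≤r block α i bound) (g₀ i)
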